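{- Let the polynomials $E_n(q)\in\mathbb{Z}[q]$ be defined by the formal power series identity $$\sum_{n\ge0}E_n(q)x^n=1+\cfrac{x}{1-x-\cfrac{\binom22_qx^2}{1-[2]_qx-\cfrac{\binom32_qx^2}{1-[3]_qx-\cfrac{\binom42_qx^2}{1-[4]_qx-\cdots}}}},$$ i.e. $b_0+\cfrac{a_1}{b_1+\cfrac{a_2}{b_2+\cdots}}$ with $b_0=1$, $a_1=x$, $a_k=-\binom k2_qx^2$ ($k\ge2$), $b_k=1-[k]_qx$ ($k\ge1$). Then $E_0(-1)=1$ and, for $n\ge1$, $$E_n(-1)=\sum_{k=0}^{n-1}\binom{n-k-1}{k}k!,$$ equivalently $$\sum_{n\ge0}\Big(\sum_{k=0}^n\binom{n-k}{k}k!\Big)x^n=\cfrac{a_1}{b_1+\cfrac{a_2}{b_2+\cdots}}$$ with $a_1=1$, $a_{2k}=a_{2k+1}=-kx^2$ ($k\ge1$), $b_{2k}=1$ ($k\ge1$), $b_{2k+1}=1-x$ ($k\ge0$).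
   Context: $[n]_q=1+q+\cdots+q^{n-1}$, $[n]!_q=[1]_q[2]_q\cdots[n]_q$, and $\binom nk_q=\frac{[n]!_q}{[k]!_q[n-k]!_q}$ (a polynomial in $q$). $E_n(-1)$ denotes evaluation of the polynomial $E_n(q)$ at $q=-1$. A continued fraction denotes the formal power series in $x$ that is the $x$-adic limit of its convergents. (At $q=1$ the $E_n(1)$ are the Euler numbers defined by $\tan x+\sec x=\sum E_nx^n/n!$.) -}

module Defs where

open import Data.Nat using (ℕ; zero; suc; _∸_; _≤_)
open import Data.Integer using (ℤ; +_; -_; _*_; _^_)
  renaming (_+_ to _+ℤ_)
open import Data.Product using (∃)
open import Relation.Binary.PropositionalEquality using (_≡_)

sumℤ : ℕ → (ℕ → ℤ) → ℤ
sumℤ zero    f = + 0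
sumℤ (suc n) f = sumℤ n f +ℤ f n

sumℕ : ℕ → (ℕ → ℕ) → ℕ
sumℕ zero    f = 0
sumℕ (suc n) f = sumℕ n f Data.Nat.+ f n

qint : ℤ → ℕ → ℤ
qint q n = sumℤ n (λ i → q ^ i)

-- Gaussian binomial [n choose k]_q, via the q-Pascal rule
-- [n+1 choose k+1] = [n choose k] + q^(k+1) [n choose k+1]
-- (this is the polynomial [n]!/([k]![n-k]!), evaluated at q).
qbinom : ℤ → ℕ → ℕ → ℤ
qbinom q zero    zero    = + 1
qbinom q zero    (suc k) = + 0
qbinom q (suc n) zero    = + 1
qbinom q (suc n) (suc k) = qbinom q n k +ℤ (q ^ suc k) * qbinom q n (suc k)

Series : Set
Series = ℕ → ℤ

const : ℤ → Series
const c zero    = c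
const c (suc n) = + 0

X : Series
X 1 = + 1
X _ = + 0

_⊕_ : Series → Series → Series
(f ⊕ g) n = f n +ℤ g n

_⊗_ : Series → Series → Series
(f ⊗ g) n = sumℤ (suc n) (λ i → f i * g (n ∸ i))

neg : Series → Series
neg f n = - f n

_⊖_ : Series → Series → Series
f ⊖ g = f ⊕ neg g

pow : Series → ℕ → Series
pow h zero    = const (+ 1)
pow h (suc k) = h ⊗ pow h k

-- Inverse of a series d with constant term 1:
-- 1/d = 1/(1 - h) = Σ_k h^k with h = 1 - d (h has zero constant term,
-- so only k ≤ n contributes to the coefficient of x^n).
inv : Series → Series
inv d n = sumℤ (suc n) (λ k → pow (const (+ 1) ⊖ d) k n)

_⊘_ : Series → Series → Series
f ⊘ d = f ⊗ inv d

-- Continued fractions  b_k + a_{k+1}/(b_{k+1} + a_{k+2}/( ... + a_{k+d}/b_{k+d}))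

cfTail : (a b : ℕ → Series) → ℕ → ℕ → Series
cfTail a b k zero    = b k
cfTail a b k (suc d) = b k ⊕ (a (suc k) ⊘ cfTail a b (suc k) d)

convergent : (a b : ℕ → Series) → ℕ → Series
convergent a b m = cfTail a b 0 m

-- The coefficient of x^n of the x-adic limit of the convergents is v:
-- the x^n coefficients of the convergents are eventually equal to v.
CFCoeff : (a b : ℕ → Series) → ℕ → ℤ → Set
CFCoeff a b n v = ∃ λ M → ∀ m → M ≤ m → convergent a b m n ≡ v

aE : ℤ → ℕ → Series
aE q zero          = const (+ 0)   -- unused
aE q (suc zero)    = X
aE q (suc (suc k)) = neg (const (qbinom q (suc (suc k)) 2) ⊗ pow X 2)

bE : ℤ → ℕ → Series
bE q zero    = const (+ 1)
bE q (suc k) = const (+ 1) ⊖ (const (qint q (suc k)) ⊗ X)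

E-is : ℤ → ℕ → ℤ → Set
E-is q n v = CFCoeff (aE q) (bE q) n v

-- The second continued fraction  a_1/(b_1 + a_2/(b_2 + ...))  (b_0 = 0)
-- a_1 = 1, a_{2k} = a_{2k+1} = -k x^2, b_{2k} = 1 (k≥1), b_{2k+1} = 1 - x.

half : ℕ → ℕ
half zero          = 0
half (suc zero)    = 0
half (suc (suc n)) = suc (half n)

aF : ℕ → Series
aF zero       = const (+ 0)   -- unused
aF (suc zero) = const (+ 1)
aF n@(suc (suc _)) = neg (const (+ half n) ⊗ pow X 2)   -- n = 2k or 2k+1 gives k

bF : ℕ → Series
bF zero                = const (+ 0)
bF (suc zero)          = const (+ 1) ⊖ X
bF (suc (suc zero))    = const (+ 1)
bF (suc (suc (suc n))) = bF (suc n)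

module Submission where

-- Put W = 1/(1-x), Y = x²/(1-x) and, for α ≥ 1, β ≥ 0,
--   K(α, β) = Σ_n G(α, β, n) Y^n W^β,   G(α, β, n) = (α)^(n) (β)^(n) / n!
-- (rising factorials).  Two Pascal-type recurrences of G, in α and in β,
-- together with (1-x) W = 1 and x² W = Y, yield the three-term relations
--   K(a+1, a)   = (1-x) K(a+1, a+1) - (a+1) x² K(a+2, a+1),
--   K(a+1, a+1) =       K(a+2, a+1) - (a+1) x² K(a+2, a+2).
-- So L_j = K(⌊j/2⌋+1, ⌈j/2⌉) satisfies L_i = b_{i+1} L_{i+1} + a_{i+2} L_{i+2} for
-- the second continued fraction, with L_0 = K(1,0) = 1 and L_1 = K(1,1) = Σ n! Y^n W,
-- whose x^m coefficient is Σ_k (m-k choose k) k!.  A general convergence lemma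
-- (any such recurrence with b_j(0) = 1, a_j(0) = 0 makes the reciprocal of the
-- tail b_1 + a_2/(b_2 + ...) converge to L_1/L_0) gives the second statement.
-- At q = -1 we have [k]_q = k mod 2 and (k choose 2)_q = ⌊k/2⌋, so the tail of
-- the E-fraction from level 1 on is the second fraction, and E = 1 + x·L_1.

open import Defs
open import Data.Nat using (ℕ; zero; suc; _∸_; _≤_; _<_; _!; z≤n; s≤s)
import Data.Nat as Nat
import Data.Nat.Properties as ℕP
import Data.Nat.Tactic.RingSolver as ℕ-Solver
open import Data.Nat.Combinatorics using (_C_; nCk+nC[k+1]≡[n+1]C[k+1])
open import Data.Integer using (ℤ; +_; -_; _+_; _*_; _-_; _^_; 0ℤ; 1ℤ; -1ℤ)
import Data.Integer.Properties as ℤP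
open import Data.Integer.Tactic.RingSolver using (solve-∀)
open import Data.Product using (_×_; _,_)
open import Relation.Binary.PropositionalEquality
open import Relation.Binary.Bundles using (Setoid)
import Relation.Binary.Reasoning.Setoid as SetoidReasoning
open import Relation.Nullary using (yes; no)

sum-cong< : ∀ n {f g : ℕ → ℤ} → (∀ i → i < n → f i ≡ g i) → sumℤ n f ≡ sumℤ n g
sum-cong< zero    eq = refl
sum-cong< (suc n) eq = cong₂ _+_ (sum-cong< n (λ i i<n → eq i (ℕP.m<n⇒m<1+n i<n))) (eq n ℕP.≤-refl)

sum-cong : ∀ n {f g : ℕ → ℤ} → (∀ i → f i ≡ g i) → sumℤ n f ≡ sumℤ n g
sum-cong n eq = sum-cong< n (λ i _ → eq i)

sum-zero : ∀ n {f : ℕ → ℤ} → (∀ i → i < n → f i ≡ 0ℤ) → sumℤ n f ≡ 0ℤ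
sum-zero zero    eq = refl
sum-zero (suc n) eq = cong₂ _+_ (sum-zero n (λ i i<n → eq i (ℕP.m<n⇒m<1+n i<n))) (eq n ℕP.≤-refl)

sum-+ : ∀ n (f g : ℕ → ℤ) → sumℤ n (λ i → f i + g i) ≡ sumℤ n f + sumℤ n g
sum-+ zero    f g = refl
sum-+ (suc n) f g = trans (cong (_+ (f n + g n)) (sum-+ n f g)) (interchange (sumℤ n f) (sumℤ n g) (f n) (g n))
  where
  interchange : ∀ (a b c d : ℤ) → (a + b) + (c + d) ≡ (a + c) + (b + d)
  interchange = solve-∀

sum-neg : ∀ n (f : ℕ → ℤ) → sumℤ n (λ i → - f i) ≡ - sumℤ n f
sum-neg zero    f = refl
sum-neg (suc n) f = trans (cong (_+ (- f n)) (sum-neg n f)) (sym (ℤP.neg-distrib-+ (sumℤ n f) (f n)))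

sum-*ˡ : ∀ n (c : ℤ) (f : ℕ → ℤ) → sumℤ n (λ i → c * f i) ≡ c * sumℤ n f
sum-*ˡ zero    c f = sym (ℤP.*-zeroʳ c)
sum-*ˡ (suc n) c f = trans (cong (_+ (c * f n)) (sum-*ˡ n c f)) (sym (ℤP.*-distribˡ-+ c (sumℤ n f) (f n)))

sum-*ʳ : ∀ n (c : ℤ) (f : ℕ → ℤ) → sumℤ n (λ i → f i * c) ≡ sumℤ n f * c
sum-*ʳ n c f = trans (sum-cong n (λ i → ℤP.*-comm (f i) c)) (trans (sum-*ˡ n c f) (ℤP.*-comm c _))

sum-head : ∀ n (f : ℕ → ℤ) → sumℤ (suc n) f ≡ f 0 + sumℤ n (λ i → f (suc i))
sum-head zero    f = trans (ℤP.+-identityˡ (f 0)) (sym (ℤP.+-identityʳ (f 0)))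
sum-head (suc n) f = trans (cong (_+ f (suc n)) (sum-head n f)) (ℤP.+-assoc (f 0) _ _)

sum-single : ∀ n (f : ℕ → ℤ) → (∀ i → i < n → f (suc i) ≡ 0ℤ) → sumℤ (suc n) f ≡ f 0
sum-single n f eq = trans (sum-head n f) (trans (cong (_+_ (f 0)) (sum-zero n eq)) (ℤP.+-identityʳ (f 0)))

sum-reverse : ∀ n (f : ℕ → ℤ) → sumℤ (suc n) f ≡ sumℤ (suc n) (λ i → f (n ∸ i))
sum-reverse zero    f = refl
sum-reverse (suc n) f = begin
    sumℤ (suc n) f + f (suc n)                        ≡⟨ cong (_+ f (suc n)) (sum-reverse n f) ⟩
    sumℤ (suc n) (λ i → f (n ∸ i)) + f (suc n)        ≡⟨ ℤP.+-comm _ (f (suc n)) ⟩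
    f (suc n) + sumℤ (suc n) (λ i → f (n ∸ i))        ≡⟨ sum-head (suc n) (λ i → f (suc n ∸ i)) ⟨
    sumℤ (suc (suc n)) (λ i → f (suc n ∸ i))          ∎
  where open ≡-Reasoning

sum-swap : ∀ n m (F : ℕ → ℕ → ℤ) →
  sumℤ n (λ i → sumℤ m (λ j → F i j)) ≡ sumℤ m (λ j → sumℤ n (λ i → F i j))
sum-swap zero    m F = sym (sum-zero m (λ _ _ → refl))
sum-swap (suc n) m F = trans (cong (_+ sumℤ m (F n)) (sum-swap n m F))
  (sym (sum-+ m (λ j → sumℤ n (λ i → F i j)) (F n)))

sum-truncate : ∀ m n (f : ℕ → ℤ) → m ≤ n → (∀ i → m ≤ i → f i ≡ 0ℤ) → sumℤ n f ≡ sumℤ m f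
sum-truncate m n f m≤n vanish = trans (cong (λ k → sumℤ k f) (sym (ℕP.m+[n∸m]≡n m≤n))) (pad (n ∸ m))
  where
  pad : ∀ k → sumℤ (m Nat.+ k) f ≡ sumℤ m f
  pad zero    = cong (λ k → sumℤ k f) (ℕP.+-identityʳ m)
  pad (suc k) = begin
      sumℤ (m Nat.+ suc k) f                ≡⟨ cong (λ k → sumℤ k f) (ℕP.+-suc m k) ⟩
      sumℤ (m Nat.+ k) f + f (m Nat.+ k)    ≡⟨ cong₂ _+_ (pad k) (vanish (m Nat.+ k) (ℕP.m≤m+n m k)) ⟩
      sumℤ m f + 0ℤ                         ≡⟨ ℤP.+-identityʳ _ ⟩
      sumℤ m f                              ∎
    where open ≡-Reasoning

sum-triangle : ∀ n (F : ℕ → ℕ → ℤ) →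
  sumℤ (suc n) (λ k → sumℤ (suc k) (λ i → F i k))
    ≡ sumℤ (suc n) (λ i → sumℤ (suc (n ∸ i)) (λ j → F i (i Nat.+ j)))
sum-triangle zero    F = refl
sum-triangle (suc n) F = begin
    Lower + (Column + F (suc n) (suc n))
  ≡⟨ cong (_+ (Column + F (suc n) (suc n))) (sum-triangle n F) ⟩
    Rows n + (Column + F (suc n) (suc n))
  ≡⟨ ℤP.+-assoc (Rows n) Column _ ⟨
    (Rows n + Column) + F (suc n) (suc n)
  ≡⟨ cong₂ _+_ (sym (sum-+ (suc n) _ (λ i → F i (suc n)))) (cong (F (suc n)) (sym (ℕP.+-identityʳ (suc n)))) ⟩
    sumℤ (suc n) (λ i → Row i n + F i (suc n)) + F (suc n) (suc n Nat.+ 0)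
  ≡⟨ cong (_+ F (suc n) (suc n Nat.+ 0)) (sum-cong< (suc n) (λ i i<sn → extend-row i (ℕP.≤-pred i<sn))) ⟩
    sumℤ (suc n) (λ i → Row i (suc n)) + F (suc n) (suc n Nat.+ 0)
  ≡⟨ cong (_+_ (sumℤ (suc n) (λ i → Row i (suc n)))) last-row ⟨
    Rows (suc n) ∎
  where
  open ≡-Reasoning
  Lower Column : ℤ
  Lower = sumℤ (suc n) (λ k → sumℤ (suc k) (λ i → F i k))
  Column = sumℤ (suc n) (λ i → F i (suc n))
  Row : ℕ → ℕ → ℤ
  Row i m = sumℤ (suc (m ∸ i)) (λ j → F i (i Nat.+ j))
  Rows : ℕ → ℤ
  Rows m = sumℤ (suc m) (λ i → Row i m)
  extend-row : ∀ i → i ≤ n → Row i n + F i (suc n) ≡ Row i (suc n)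
  extend-row i i≤n rewrite ℕP.+-∸-assoc 1 i≤n =
    cong (_+_ (Row i n)) (cong (F i) (sym (trans (ℕP.+-suc i (n ∸ i)) (cong suc (ℕP.m+[n∸m]≡n i≤n)))))
  last-row : Row (suc n) (suc n) ≡ F (suc n) (suc n Nat.+ 0)
  last-row = trans (cong (λ k → sumℤ (suc k) (λ j → F (suc n) (suc n Nat.+ j))) (ℕP.n∸n≡0 n)) (ℤP.+-identityˡ _)

telescope : ∀ N (P : ℕ → ℤ) → sumℤ N (λ k → P k - P (suc k)) ≡ P 0 - P N
telescope zero    P = sym (ℤP.+-inverseʳ (P 0))
telescope (suc N) P = trans (cong (_+ (P N - P (suc N))) (telescope N P)) (collapse (P 0) (P N) (P (suc N)))
  where
  collapse : ∀ (a b c : ℤ) → (a - b) + (b - c) ≡ a - c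
  collapse = solve-∀

sum-pos : ∀ N (f : ℕ → ℕ) → sumℤ N (λ k → + f k) ≡ + sumℕ N f
sum-pos zero    f = refl
sum-pos (suc N) f = trans (cong (_+ (+ f N)) (sum-pos N f)) (sym (ℤP.pos-+ (sumℕ N f) (f N)))

sumℕ-cong : ∀ N {f g : ℕ → ℕ} → (∀ i → f i ≡ g i) → sumℕ N f ≡ sumℕ N g
sumℕ-cong zero    eq = refl
sumℕ-cong (suc N) eq = cong₂ Nat._+_ (sumℕ-cong N eq) (eq N)

module ≗ = Setoid (ℕ →-setoid ℤ)
module ≗-Reasoning = SetoidReasoning (ℕ →-setoid ℤ)

one : Series
one = const 1ℤ

shift : Series → Series
shift f zero    = 0ℤ
shift f (suc n) = f n

⊕-cong : ∀ {f f′ g g′ : Series} → f ≗ f′ → g ≗ g′ → (f ⊕ g) ≗ (f′ ⊕ g′)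
⊕-cong p q n = cong₂ _+_ (p n) (q n)

neg-cong : ∀ {f f′ : Series} → f ≗ f′ → neg f ≗ neg f′
neg-cong p n = cong -_ (p n)

⊗-cong : ∀ {f f′ g g′ : Series} → f ≗ f′ → g ≗ g′ → (f ⊗ g) ≗ (f′ ⊗ g′)
⊗-cong p q n = sum-cong (suc n) (λ i → cong₂ _*_ (p i) (q (n ∸ i)))

⊗-congˡ : ∀ {f f′ : Series} g → f ≗ f′ → (f ⊗ g) ≗ (f′ ⊗ g)
⊗-congˡ g p = ⊗-cong {g = g} p (λ _ → refl)

⊗-congʳ : ∀ f {g g′ : Series} → g ≗ g′ → (f ⊗ g) ≗ (f ⊗ g′)
⊗-congʳ f q = ⊗-cong {f = f} (λ _ → refl) q

⊗-comm : ∀ f g → (f ⊗ g) ≗ (g ⊗ f)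
⊗-comm f g n = trans (sum-reverse n (λ i → f i * g (n ∸ i)))
  (sum-cong< (suc n) (λ i i≤n → trans (cong (λ j → f (n ∸ i) * g j) (ℕP.m∸[m∸n]≡n (ℕP.≤-pred i≤n)))
                                      (ℤP.*-comm (f (n ∸ i)) (g i))))

-- Associativity of the Cauchy product: both sides sum f_i g_j h_l over i + j + l = n.
⊗-assoc : ∀ f g h → ((f ⊗ g) ⊗ h) ≗ (f ⊗ (g ⊗ h))
⊗-assoc f g h n = begin
    sumℤ (suc n) (λ k → sumℤ (suc k) (λ i → f i * g (k ∸ i)) * h (n ∸ k))
  ≡⟨ sum-cong (suc n) (λ k → sym (sum-*ʳ (suc k) (h (n ∸ k)) (λ i → f i * g (k ∸ i)))) ⟩
    sumℤ (suc n) (λ k → sumℤ (suc k) (λ i → f i * g (k ∸ i) * h (n ∸ k)))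
  ≡⟨ sum-triangle n (λ i k → f i * g (k ∸ i) * h (n ∸ k)) ⟩
    sumℤ (suc n) (λ i → sumℤ (suc (n ∸ i)) (λ j → f i * g ((i Nat.+ j) ∸ i) * h (n ∸ (i Nat.+ j))))
  ≡⟨ sum-cong (suc n) (λ i → sum-cong (suc (n ∸ i)) (λ j →
       trans (cong₂ (λ a b → f i * g a * h b) (ℕP.m+n∸m≡n i j) (sym (ℕP.∸-+-assoc n i j)))
             (ℤP.*-assoc (f i) (g j) (h (n ∸ i ∸ j))))) ⟩
    sumℤ (suc n) (λ i → sumℤ (suc (n ∸ i)) (λ j → f i * (g j * h (n ∸ i ∸ j))))
  ≡⟨ sum-cong (suc n) (λ i → sum-*ˡ (suc (n ∸ i)) (f i) (λ j → g j * h (n ∸ i ∸ j))) ⟩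
    sumℤ (suc n) (λ i → f i * sumℤ (suc (n ∸ i)) (λ j → g j * h (n ∸ i ∸ j))) ∎
  where open ≡-Reasoning

⊗-exchange : ∀ a b c → (a ⊗ (b ⊗ c)) ≗ (b ⊗ (a ⊗ c))
⊗-exchange a b c = begin
  a ⊗ (b ⊗ c)   ≈⟨ ⊗-assoc a b c ⟨
  (a ⊗ b) ⊗ c   ≈⟨ ⊗-congˡ c (⊗-comm a b) ⟩
  (b ⊗ a) ⊗ c   ≈⟨ ⊗-assoc b a c ⟩
  b ⊗ (a ⊗ c)   ∎
  where open ≗-Reasoning

⊗-distribʳ : ∀ f g h → ((g ⊕ h) ⊗ f) ≗ ((g ⊗ f) ⊕ (h ⊗ f))
⊗-distribʳ f g h n = trans (sum-cong (suc n) (λ i → ℤP.*-distribʳ-+ (f (n ∸ i)) (g i) (h i)))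
  (sum-+ (suc n) (λ i → g i * f (n ∸ i)) (λ i → h i * f (n ∸ i)))

⊗-negˡ : ∀ f g → (neg f ⊗ g) ≗ neg (f ⊗ g)
⊗-negˡ f g n = trans (sum-cong (suc n) (λ i → sym (ℤP.neg-distribˡ-* (f i) (g (n ∸ i)))))
  (sum-neg (suc n) _)

const-⊗ : ∀ c f → (const c ⊗ f) ≗ (λ n → c * f n)
const-⊗ c f n = sum-single n (λ i → const c i * f (n ∸ i)) (λ _ _ → refl)

one-⊗ : ∀ f → (one ⊗ f) ≗ f
one-⊗ f n = trans (const-⊗ 1ℤ f n) (ℤP.*-identityˡ (f n))

⊗-one : ∀ f → (f ⊗ one) ≗ f
⊗-one f = ≗.trans (⊗-comm f one) (one-⊗ f)

X-⊗ : ∀ f → (X ⊗ f) ≗ shift f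
X-⊗ f zero    = refl
X-⊗ f (suc n) = begin
  sumℤ (suc (suc n)) (λ i → X i * f (suc n ∸ i))   ≡⟨ sum-head (suc n) _ ⟩
  0ℤ + sumℤ (suc n) (λ i → X (suc i) * f (n ∸ i))  ≡⟨ ℤP.+-identityˡ _ ⟩
  sumℤ (suc n) (λ i → X (suc i) * f (n ∸ i))       ≡⟨ sum-single n _ (λ _ _ → refl) ⟩
  1ℤ * f n                                         ≡⟨ ℤP.*-identityˡ (f n) ⟩
  f n                                              ∎
  where open ≡-Reasoning

shift-cong : ∀ {f g : Series} → f ≗ g → shift f ≗ shift g
shift-cong p zero    = refl
shift-cong p (suc n) = p n

X²-⊗ : ∀ f → (pow X 2 ⊗ f) ≗ shift (shift f)
X²-⊗ f = begin
  (X ⊗ (X ⊗ one)) ⊗ f    ≈⟨ ⊗-assoc X (X ⊗ one) f ⟩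
  X ⊗ ((X ⊗ one) ⊗ f)    ≈⟨ ⊗-congʳ X (⊗-assoc X one f) ⟩
  X ⊗ (X ⊗ (one ⊗ f))    ≈⟨ X-⊗ _ ⟩
  shift (X ⊗ (one ⊗ f))  ≈⟨ shift-cong (≗.trans (X-⊗ _) (shift-cong (one-⊗ f))) ⟩
  shift (shift f)        ∎
  where open ≗-Reasoning

HasOrder : ℕ → Series → Set
HasOrder k f = ∀ r → r < k → f r ≡ 0ℤ

_≈[_]_ : Series → ℕ → Series → Set
f ≈[ N ] g = ∀ n → n < N → f n ≡ g n

⊗-at-0 : ∀ f g → (f ⊗ g) 0 ≡ f 0 * g 0
⊗-at-0 f g = ℤP.+-identityˡ (f 0 * g 0)

⊗-orderˡ : ∀ {k f} g → HasOrder k f → HasOrder k (f ⊗ g)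
⊗-orderˡ g ord r r<k =
  sum-zero (suc r) (λ i i≤r → cong (_* g (r ∸ i)) (ord i (ℕP.<-≤-trans i≤r r<k)))

pow-order : ∀ {h} → HasOrder 1 h → ∀ k → HasOrder k (pow h k)
pow-order {h} h0 (suc k) m (s≤s m≤k) = sum-zero (suc m) term
  where
  term : ∀ i → i < suc m → h i * pow h k (m ∸ i) ≡ 0ℤ
  term zero    _         = cong (_* pow h k m) (h0 0 (s≤s z≤n))
  term (suc i) (s≤s i<m) = trans (cong (h (suc i) *_) (pow-order h0 k (m ∸ suc i) below)) (ℤP.*-zeroʳ (h (suc i)))
    where
    below : m ∸ suc i < k
    below = ℕP.<-≤-trans (ℕP.∸-monoʳ-< (s≤s z≤n) i<m) m≤k

⊗-congʳ-≈ : ∀ {g g′ N} f → g ≈[ N ] g′ → (f ⊗ g) ≈[ N ] (f ⊗ g′)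
⊗-congʳ-≈ f p n n<N = sum-cong (suc n) (λ i → cong (f i *_) (p (n ∸ i) (ℕP.≤-<-trans (ℕP.m∸n≤m n i) n<N)))

⊗-order1-≈ : ∀ {g g′ N} a → a 0 ≡ 0ℤ → g ≈[ N ] g′ → (a ⊗ g) ≈[ suc N ] (a ⊗ g′)
⊗-order1-≈ {g} {g′} a a0 p n n≤N = sum-cong< (suc n) term
  where
  term : ∀ i → i < suc n → a i * g (n ∸ i) ≡ a i * g′ (n ∸ i)
  term zero    _         rewrite a0 = refl
  term (suc i) (s≤s i<n) = cong (a (suc i) *_) (p (n ∸ suc i) (ℕP.<-≤-trans (ℕP.∸-monoʳ-< (s≤s z≤n) i<n) (ℕP.≤-pred n≤N)))

⊗-sum : ∀ N f (F : ℕ → Series) m →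
  (f ⊗ (λ r → sumℤ N (λ k → F k r))) m ≡ sumℤ N (λ k → (f ⊗ F k) m)
⊗-sum N f F m = trans (sum-cong (suc m) (λ i → sym (sum-*ˡ N (f i) (λ k → F k (m ∸ i)))))
  (sum-swap (suc m) N (λ i k → f i * F k (m ∸ i)))

-- u · Σ_k (1-u)^k telescopes to 1 - (1-u)^(m+1), whose x^m coefficient is 1.
inv-right : ∀ u → u 0 ≡ 1ℤ → (u ⊗ inv u) ≗ one
inv-right u u0 m = begin
    sumℤ (suc m) (λ i → u i * inv u (m ∸ i))
  ≡⟨ sum-cong (suc m) (λ i → cong (u i *_) (sym (partial-sums i))) ⟩
    (u ⊗ (λ r → sumℤ (suc m) (λ k → pow h k r))) m
  ≡⟨ ⊗-sum (suc m) u (pow h) m ⟩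
    sumℤ (suc m) (λ k → (u ⊗ pow h k) m)
  ≡⟨ sum-cong (suc m) difference ⟩
    sumℤ (suc m) (λ k → pow h k m - pow h (suc k) m)
  ≡⟨ telescope (suc m) (λ k → pow h k m) ⟩
    one m - pow h (suc m) m
  ≡⟨ cong (λ z → one m - z) (pow-order h-order (suc m) m ℕP.≤-refl) ⟩
    one m - 0ℤ
  ≡⟨ ℤP.+-identityʳ (one m) ⟩
    one m ∎
  where
  open ≡-Reasoning
  h : Series
  h = one ⊖ u
  h-order : HasOrder 1 h
  h-order zero    _ rewrite u0 = refl
  h-order (suc r) (s≤s ())
  -- only the powers h^k with k ≤ r contribute to the coefficient of x^r
  partial-sums : ∀ i → sumℤ (suc m) (λ k → pow h k (m ∸ i)) ≡ inv u (m ∸ i)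
  partial-sums i = sum-truncate (suc (m ∸ i)) (suc m) (λ k → pow h k (m ∸ i)) (s≤s (ℕP.m∸n≤m m i))
    (λ k k>r → pow-order h-order k (m ∸ i) k>r)
  -- u = 1 - h, so u h^k = h^k - h^(k+1)
  difference : ∀ k → (u ⊗ pow h k) m ≡ pow h k m - pow h (suc k) m
  difference k = begin
      (u ⊗ pow h k) m
    ≡⟨ ⊗-congˡ (pow h k) (λ r → u≡1-h (one r) (u r)) m ⟩
      ((one ⊕ neg h) ⊗ pow h k) m
    ≡⟨ ⊗-distribʳ (pow h k) one (neg h) m ⟩
      (one ⊗ pow h k) m + (neg h ⊗ pow h k) m
    ≡⟨ cong₂ _+_ (one-⊗ (pow h k) m) (⊗-negˡ h (pow h k) m) ⟩
      pow h k m - pow h (suc k) m ∎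
    where
    u≡1-h : ∀ (a x : ℤ) → x ≡ a + - (a + - x)
    u≡1-h = solve-∀

inv-left : ∀ u → u 0 ≡ 1ℤ → (inv u ⊗ u) ≗ one
inv-left u u0 = ≗.trans (⊗-comm (inv u) u) (inv-right u u0)

inv-cancel : ∀ u f → u 0 ≡ 1ℤ → (inv u ⊗ (u ⊗ f)) ≗ f
inv-cancel u f u0 = begin
  inv u ⊗ (u ⊗ f)   ≈⟨ ⊗-assoc (inv u) u f ⟨
  (inv u ⊗ u) ⊗ f   ≈⟨ ⊗-congˡ f (inv-left u u0) ⟩
  one ⊗ f           ≈⟨ one-⊗ f ⟩
  f                 ∎
  where open ≗-Reasoning

pow-cong : ∀ {h h′ : Series} → h ≗ h′ → ∀ k → pow h k ≗ pow h′ k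
pow-cong p zero    n = refl
pow-cong p (suc k) = ⊗-cong p (pow-cong p k)

inv-cong : ∀ {d d′ : Series} → d ≗ d′ → inv d ≗ inv d′
inv-cong p n = sum-cong (suc n) (λ k → pow-cong (⊕-cong {f = one} (λ _ → refl) (neg-cong p)) k n)

module Convergence
  (a b K : ℕ → Series)
  (b-unit : ∀ j → b (suc j) 0 ≡ 1ℤ)
  (a-order : ∀ j → a (suc (suc j)) 0 ≡ 0ℤ)
  (recurrence : ∀ i → K i ≗ ((b (suc i) ⊗ K (suc i)) ⊕ (a (suc (suc i)) ⊗ K (suc (suc i)))))
  where

  tail-unit : ∀ j d → cfTail a b (suc j) d 0 ≡ 1ℤ
  tail-unit j zero    = b-unit j
  tail-unit j (suc d) = begin
    b (suc j) 0 + (a (suc (suc j)) ⊗ inv (cfTail a b (suc (suc j)) d)) 0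
      ≡⟨ cong₂ _+_ (b-unit j) (⊗-at-0 (a (suc (suc j))) (inv (cfTail a b (suc (suc j)) d))) ⟩
    1ℤ + a (suc (suc j)) 0 * inv (cfTail a b (suc (suc j)) d) 0
      ≡⟨ cong (λ c → 1ℤ + c * inv (cfTail a b (suc (suc j)) d) 0) (a-order j) ⟩
    1ℤ ∎
    where open ≡-Reasoning

  -- The depth-d tail starting at b_{i+1}, times K_{i+1}, agrees with K_i below x^(d+1);
  -- each extra level gains a degree because a_{i+2} has no constant term.
  tail-approx : ∀ d i → (cfTail a b (suc i) d ⊗ K (suc i)) ≈[ suc d ] K i
  tail-approx zero i zero _ = sym (begin
    K i 0                              ≡⟨ recurrence i 0 ⟩
    bK + (a′ ⊗ K (suc (suc i))) 0      ≡⟨ cong (_+_ bK) (⊗-at-0 a′ (K (suc (suc i)))) ⟩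
    bK + a′ 0 * K (suc (suc i)) 0      ≡⟨ cong (λ c → bK + c * K (suc (suc i)) 0) (a-order i) ⟩
    bK + 0ℤ                            ≡⟨ ℤP.+-identityʳ bK ⟩
    bK                                 ∎)
    where
    open ≡-Reasoning
    a′ : Series
    a′ = a (suc (suc i))
    bK : ℤ
    bK = (b (suc i) ⊗ K (suc i)) 0
  tail-approx zero i (suc n) (s≤s ())
  tail-approx (suc d) i n n≤d = begin
      ((b (suc i) ⊕ (a′ ⊗ inv Tail)) ⊗ K (suc i)) n
    ≡⟨ ⊗-distribʳ (K (suc i)) (b (suc i)) (a′ ⊗ inv Tail) n ⟩
      (b (suc i) ⊗ K (suc i)) n + ((a′ ⊗ inv Tail) ⊗ K (suc i)) n
    ≡⟨ cong (_+_ ((b (suc i) ⊗ K (suc i)) n)) (⊗-assoc a′ (inv Tail) (K (suc i)) n) ⟩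
      (b (suc i) ⊗ K (suc i)) n + (a′ ⊗ (inv Tail ⊗ K (suc i))) n
    ≡⟨ cong (_+_ ((b (suc i) ⊗ K (suc i)) n)) (⊗-order1-≈ a′ (a-order i) next n n≤d) ⟩
      (b (suc i) ⊗ K (suc i)) n + (a′ ⊗ K (suc (suc i))) n
    ≡⟨ recurrence i n ⟨
      K i n ∎
    where
    open ≡-Reasoning
    a′ Tail : Series
    a′ = a (suc (suc i))
    Tail = cfTail a b (suc (suc i)) d
    -- by induction Tail K_{i+2} ≈ K_{i+1}, hence K_{i+1}/Tail ≈ K_{i+2}
    next : (inv Tail ⊗ K (suc i)) ≈[ suc d ] K (suc (suc i))
    next r r≤d = trans (⊗-congʳ-≈ (inv Tail) (λ s s≤d → sym (tail-approx d (suc i) s s≤d)) r r≤d)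
                       (inv-cancel Tail (K (suc (suc i))) (tail-unit (suc i) d) r)

  inverse-tail : K 0 ≗ one → ∀ d n → n ≤ d → inv (cfTail a b 1 d) n ≡ K 1 n
  inverse-tail K0 d n n≤d = begin
    inv Tail n                     ≡⟨ ⊗-one (inv Tail) n ⟨
    (inv Tail ⊗ one) n             ≡⟨ ⊗-congʳ-≈ (inv Tail) (λ r r≤d → sym (trans (tail-approx d 0 r r≤d) (K0 r))) n (s≤s n≤d) ⟩
    (inv Tail ⊗ (Tail ⊗ K 1)) n    ≡⟨ inv-cancel Tail (K 1) (tail-unit 0 d) n ⟩
    K 1 n                          ∎
    where
    open ≡-Reasoning
    Tail : Series
    Tail = cfTail a b 1 d

-- multichoose α n = (α+n-1 choose n), the number of size-n multisets of α kinds.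
multichoose : ℕ → ℕ → ℕ
multichoose α       zero    = 1
multichoose zero    (suc m) = 0
multichoose (suc α) (suc m) = multichoose α (suc m) Nat.+ multichoose (suc α) m

rising : ℕ → ℕ → ℕ
rising β zero    = 1
rising β (suc n) = β Nat.* rising (suc β) n

multichoose-absorb : ∀ α m → suc m Nat.* multichoose α (suc m) ≡ α Nat.* multichoose (suc α) m
multichoose-absorb zero    m       = ℕP.*-zeroʳ (suc m)
multichoose-absorb (suc α) zero    = begin
    1 Nat.* (multichoose α 1 Nat.+ 1)   ≡⟨ ℕP.*-identityˡ _ ⟩
    multichoose α 1 Nat.+ 1             ≡⟨ cong (Nat._+ 1) (trans (sym (ℕP.*-identityˡ _)) (multichoose-absorb α zero)) ⟩
    α Nat.* 1 Nat.+ 1                   ≡⟨ cong (Nat._+ 1) (ℕP.*-identityʳ α) ⟩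
    α Nat.+ 1                           ≡⟨ ℕP.+-comm α 1 ⟩
    suc α                               ≡⟨ ℕP.*-identityʳ (suc α) ⟨
    suc α Nat.* 1 ∎
  where open ≡-Reasoning
multichoose-absorb (suc α) (suc m) = begin
    suc (suc m) Nat.* (A₁ Nat.+ A₂)
  ≡⟨ split m A₁ A₂ ⟩
    suc (suc m) Nat.* A₁ Nat.+ (suc m Nat.* A₂ Nat.+ A₂)
  ≡⟨ cong₂ Nat._+_ (multichoose-absorb α (suc m)) (cong (Nat._+ A₂) (multichoose-absorb (suc α) m)) ⟩
    α Nat.* A₂ Nat.+ (suc α Nat.* multichoose (suc (suc α)) m Nat.+ A₂)
  ≡⟨ merge α A₂ (multichoose (suc (suc α)) m) ⟩
    suc α Nat.* (A₂ Nat.+ multichoose (suc (suc α)) m) ∎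
  where
  open ≡-Reasoning
  A₁ A₂ : ℕ
  A₁ = multichoose α (suc (suc m))
  A₂ = multichoose (suc α) (suc m)
  split : ∀ m x y → suc (suc m) Nat.* (x Nat.+ y) ≡ suc (suc m) Nat.* x Nat.+ (suc m Nat.* y Nat.+ y)
  split = ℕ-Solver.solve-∀
  merge : ∀ a y z → a Nat.* y Nat.+ (suc a Nat.* z Nat.+ y) ≡ suc a Nat.* (y Nat.+ z)
  merge = ℕ-Solver.solve-∀

rising-last : ∀ β m → rising β (suc m) ≡ rising β m Nat.* (β Nat.+ m)
rising-last β zero    = trans (ℕP.*-identityʳ β) (sym (trans (ℕP.*-identityˡ (β Nat.+ 0)) (ℕP.+-identityʳ β)))
rising-last β (suc m) = trans (cong (β Nat.*_) (rising-last (suc β) m)) (reassoc m β (rising (suc β) m))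
  where
  reassoc : ∀ m β r → β Nat.* (r Nat.* (suc β Nat.+ m)) ≡ β Nat.* r Nat.* (β Nat.+ suc m)
  reassoc = ℕ-Solver.solve-∀

rising-step : ∀ β m → rising (suc β) (suc m) ≡ rising β (suc m) Nat.+ suc m Nat.* rising (suc β) m
rising-step β m = trans (rising-last (suc β) m) (expand β m (rising (suc β) m))
  where
  expand : ∀ β m r → r Nat.* (suc β Nat.+ m) ≡ β Nat.* r Nat.+ suc m Nat.* r
  expand = ℕ-Solver.solve-∀

G : ℕ → ℕ → ℕ → ℕ
G α β n = multichoose α n Nat.* rising β n

G-step-β : ∀ α β m → G α (suc β) (suc m) ≡ G α β (suc m) Nat.+ α Nat.* G (suc α) (suc β) m
G-step-β α β m = begin
    A Nat.* rising (suc β) (suc m)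
  ≡⟨ cong (A Nat.*_) (rising-step β m) ⟩
    A Nat.* (rising β (suc m) Nat.+ suc m Nat.* rising (suc β) m)
  ≡⟨ distribute A (rising β (suc m)) (suc m) (rising (suc β) m) ⟩
    A Nat.* rising β (suc m) Nat.+ (suc m Nat.* A) Nat.* rising (suc β) m
  ≡⟨ cong (λ z → A Nat.* rising β (suc m) Nat.+ z Nat.* rising (suc β) m) (multichoose-absorb α m) ⟩
    A Nat.* rising β (suc m) Nat.+ (α Nat.* multichoose (suc α) m) Nat.* rising (suc β) m
  ≡⟨ cong (A Nat.* rising β (suc m) Nat.+_) (ℕP.*-assoc α (multichoose (suc α) m) (rising (suc β) m)) ⟩
    A Nat.* rising β (suc m) Nat.+ α Nat.* G (suc α) (suc β) m ∎
  where
  open ≡-Reasoning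
  A : ℕ
  A = multichoose α (suc m)
  distribute : ∀ a r s t → a Nat.* (r Nat.+ s Nat.* t) ≡ a Nat.* r Nat.+ (s Nat.* a) Nat.* t
  distribute = ℕ-Solver.solve-∀

G-step-α : ∀ α β m → G (suc α) β (suc m) ≡ G α β (suc m) Nat.+ β Nat.* G (suc α) (suc β) m
G-step-α α β m = distribute (multichoose α (suc m)) (multichoose (suc α) m) β (rising (suc β) m)
  where
  distribute : ∀ x y β r → (x Nat.+ y) Nat.* (β Nat.* r) ≡ x Nat.* (β Nat.* r) Nat.+ β Nat.* (y Nat.* r)
  distribute = ℕ-Solver.solve-∀

G-1-0 : ∀ m → G 1 0 (suc m) ≡ 0
G-1-0 m = ℕP.*-zeroʳ (multichoose 1 (suc m))

G-1-1 : ∀ n → G 1 1 n ≡ n !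
G-1-1 n = trans (cong₂ Nat._*_ (multichoose-1 n) (rising-1 n)) (ℕP.*-identityˡ (n !))
  where
  multichoose-1 : ∀ n → multichoose 1 n ≡ 1
  multichoose-1 zero    = refl
  multichoose-1 (suc n) = multichoose-1 n
  rising-1 : ∀ n → rising 1 n ≡ n !
  rising-1 zero    = refl
  rising-1 (suc n) = trans (rising-last 1 n) (trans (ℕP.*-comm (rising 1 n) (suc n)) (cong (suc n Nat.*_) (rising-1 n)))

diagonal-pascal : ∀ n k → (suc k ∸ n) C suc n ≡ (k ∸ n) C suc n Nat.+ (k ∸ n) C n
diagonal-pascal n k with n ℕP.≤? k
... | yes n≤k = begin
    (suc k ∸ n) C suc n                     ≡⟨ cong (_C suc n) (ℕP.+-∸-assoc 1 n≤k) ⟩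
    suc (k ∸ n) C suc n                     ≡⟨ nCk+nC[k+1]≡[n+1]C[k+1] (k ∸ n) n ⟨
    (k ∸ n) C n Nat.+ (k ∸ n) C suc n       ≡⟨ ℕP.+-comm ((k ∸ n) C n) _ ⟩
    (k ∸ n) C suc n Nat.+ (k ∸ n) C n       ∎
  where open ≡-Reasoning
... | no n≰k = vanishing (ℕP.≰⇒> n≰k)
  where
  -- for k < n all three binomials have an empty range
  vanishing : ∀ {n k} → k < n → (suc k ∸ n) C suc n ≡ (k ∸ n) C suc n Nat.+ (k ∸ n) C n
  vanishing {suc n} k<n rewrite ℕP.m≤n⇒m∸n≡0 k<n | ℕP.m≤n⇒m∸n≡0 (ℕP.<⇒≤ k<n) = refl

W : Series
W = inv (one ⊖ X)

Y : Series
Y = pow X 2 ⊗ W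

T : ℕ → ℕ → Series
T γ n = pow Y n ⊗ pow W γ

-- Y has no constant term, so T γ n has order at least n.
T-order : ∀ γ n → HasOrder n (T γ n)
T-order γ n = ⊗-orderˡ (pow W γ) (pow-order Y-order n)
  where
  Y-order : HasOrder 1 Y
  Y-order zero    _        = X²-⊗ W 0
  Y-order (suc r) (s≤s ())

T-lower-γ : ∀ γ n → ((one ⊖ X) ⊗ T (suc γ) n) ≗ T γ n
T-lower-γ γ n = begin
  (one ⊖ X) ⊗ (pow Y n ⊗ (W ⊗ pow W γ))      ≈⟨ ⊗-exchange (one ⊖ X) (pow Y n) (W ⊗ pow W γ) ⟩
  pow Y n ⊗ ((one ⊖ X) ⊗ (W ⊗ pow W γ))      ≈⟨ ⊗-congʳ (pow Y n) (⊗-assoc (one ⊖ X) W (pow W γ)) ⟨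
  pow Y n ⊗ (((one ⊖ X) ⊗ W) ⊗ pow W γ)      ≈⟨ ⊗-congʳ (pow Y n) (⊗-congˡ (pow W γ) (inv-right (one ⊖ X) refl)) ⟩
  pow Y n ⊗ (one ⊗ pow W γ)                  ≈⟨ ⊗-congʳ (pow Y n) (one-⊗ (pow W γ)) ⟩
  T γ n                                      ∎
  where open ≗-Reasoning

T-raise-n : ∀ γ n → (pow X 2 ⊗ T (suc γ) n) ≗ T γ (suc n)
T-raise-n γ n = begin
  pow X 2 ⊗ (pow Y n ⊗ (W ⊗ pow W γ))   ≈⟨ ⊗-exchange (pow X 2) (pow Y n) (W ⊗ pow W γ) ⟩
  pow Y n ⊗ (pow X 2 ⊗ (W ⊗ pow W γ))   ≈⟨ ⊗-congʳ (pow Y n) (⊗-assoc (pow X 2) W (pow W γ)) ⟨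
  pow Y n ⊗ (Y ⊗ pow W γ)               ≈⟨ ⊗-exchange (pow Y n) Y (pow W γ) ⟩
  Y ⊗ (pow Y n ⊗ pow W γ)               ≈⟨ ⊗-assoc Y (pow Y n) (pow W γ) ⟨
  T γ (suc n)                           ∎
  where open ≗-Reasoning

solve-1-x : ∀ f g → ((one ⊖ X) ⊗ f) ≗ g → f ≗ (W ⊗ g)
solve-1-x f g eq = ≗.sym (≗.trans (⊗-congʳ W (≗.sym eq)) (inv-cancel (one ⊖ X) f refl))

1-x-⊗ : ∀ f → ((one ⊖ X) ⊗ f) ≗ (f ⊕ neg (shift f))
1-x-⊗ f = ≗.trans (⊗-distribʳ f one (neg X))
  (⊕-cong (one-⊗ f) (≗.trans (⊗-negˡ X f) (neg-cong (X-⊗ f))))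

diagonal : ℕ → Series
diagonal n m = + ((m ∸ n) C n)

T-1 : ∀ n → T 1 n ≗ diagonal n
T-1 zero    = ≗.trans (one-⊗ (W ⊗ one)) (≗.sym (solve-1-x (diagonal 0) one (≗.trans (1-x-⊗ (diagonal 0)) differences)))
  where
  differences : (diagonal 0 ⊕ neg (shift (diagonal 0))) ≗ one
  differences zero    = refl
  differences (suc m) = refl
T-1 (suc n) = begin
  (Y ⊗ pow Y n) ⊗ (W ⊗ one)       ≈⟨ ⊗-assoc Y (pow Y n) (W ⊗ one) ⟩
  Y ⊗ T 1 n                       ≈⟨ ⊗-congʳ Y (T-1 n) ⟩
  (pow X 2 ⊗ W) ⊗ diagonal n      ≈⟨ ⊗-assoc (pow X 2) W (diagonal n) ⟩
  pow X 2 ⊗ (W ⊗ diagonal n)      ≈⟨ ⊗-exchange (pow X 2) W (diagonal n) ⟩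
  W ⊗ (pow X 2 ⊗ diagonal n)      ≈⟨ solve-1-x (diagonal (suc n)) _ (≗.trans (1-x-⊗ (diagonal (suc n))) differences) ⟨
  diagonal (suc n)                ∎
  where
  open ≗-Reasoning
  differences : (diagonal (suc n) ⊕ neg (shift (diagonal (suc n)))) ≗ (pow X 2 ⊗ diagonal n)
  differences m = trans (pascal m) (sym (X²-⊗ (diagonal n) m))
    where
    pascal : ∀ m → diagonal (suc n) m - shift (diagonal (suc n)) m ≡ shift (shift (diagonal n)) m
    pascal zero          = refl
    pascal (suc zero)    rewrite ℕP.0∸n≡0 n = refl
    pascal (suc (suc k)) rewrite diagonal-pascal n k = cancel ((k ∸ n) C suc n) ((k ∸ n) C n)
      where
      cancel : ∀ x y → + (x Nat.+ y) - + x ≡ + y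
      cancel x y = trans (cong (_- + x) (ℤP.pos-+ x y)) (eq (+ x) (+ y))
        where
        eq : ∀ (a b : ℤ) → a + b - a ≡ b
        eq = solve-∀

Graded : (ℕ → Series) → Set
Graded S = ∀ n → HasOrder n (S n)

-- Only S_0 .. S_m contribute to the coefficient of x^m.
wsum : (ℕ → ℕ) → (ℕ → Series) → Series
wsum g S m = sumℤ (suc m) (λ n → + g n * S n m)

wsum-congʳ : ∀ {S S′} g → (∀ n → S n ≗ S′ n) → wsum g S ≗ wsum g S′
wsum-congʳ g eq m = sum-cong (suc m) (λ n → cong (+ g n *_) (eq n m))

wsum-extend : ∀ {S} g → Graded S → ∀ {m N} → m ≤ N → sumℤ (suc N) (λ n → + g n * S n m) ≡ wsum g S m
wsum-extend {S} g graded m≤N = sum-truncate (suc _) _ (λ n → + g n * S n _) (s≤s m≤N)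
  (λ n m<n → trans (cong (+ g n *_) (graded n _ m<n)) (ℤP.*-zeroʳ (+ g n)))

⊗-wsum : ∀ {S} g → Graded S → ∀ s → (s ⊗ wsum g S) ≗ wsum g (λ n → s ⊗ S n)
⊗-wsum {S} g graded s m = begin
    sumℤ (suc m) (λ i → s i * wsum g S (m ∸ i))
  ≡⟨ sum-cong (suc m) (λ i → cong (s i *_) (sym (wsum-extend g graded (ℕP.m∸n≤m m i)))) ⟩
    sumℤ (suc m) (λ i → s i * sumℤ (suc m) (λ n → + g n * S n (m ∸ i)))
  ≡⟨ sum-cong (suc m) (λ i → sym (sum-*ˡ (suc m) (s i) (λ n → + g n * S n (m ∸ i)))) ⟩
    sumℤ (suc m) (λ i → sumℤ (suc m) (λ n → s i * (+ g n * S n (m ∸ i))))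
  ≡⟨ sum-swap (suc m) (suc m) (λ i n → s i * (+ g n * S n (m ∸ i))) ⟩
    sumℤ (suc m) (λ n → sumℤ (suc m) (λ i → s i * (+ g n * S n (m ∸ i))))
  ≡⟨ sum-cong (suc m) (λ n → trans (sum-cong (suc m) (λ i → exchange (s i) (+ g n) (S n (m ∸ i))))
                                   (sum-*ˡ (suc m) (+ g n) (λ i → s i * S n (m ∸ i)))) ⟩
    sumℤ (suc m) (λ n → + g n * (s ⊗ S n) m) ∎
  where
  open ≡-Reasoning
  exchange : ∀ (s g x : ℤ) → s * (g * x) ≡ g * (s * x)
  exchange = solve-∀

wsum-split : ∀ {S} (g₁ g₀ g₂ : ℕ → ℕ) c → Graded S → g₁ 0 ≡ g₀ 0 →
  (∀ n → g₁ (suc n) ≡ g₀ (suc n) Nat.+ c Nat.* g₂ n) →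
  wsum g₁ S ≗ (wsum g₀ S ⊕ (const (+ c) ⊗ wsum g₂ (λ n → S (suc n))))
wsum-split {S} g₁ g₀ g₂ c graded eq₀ eq m = begin
    wsum g₁ S m
  ≡⟨ sum-head m (λ n → + g₁ n * S n m) ⟩
    + g₁ 0 * S 0 m + sumℤ m (λ n → + g₁ (suc n) * S (suc n) m)
  ≡⟨ cong₂ _+_ (cong (λ k → + k * S 0 m) eq₀) (sum-cong m (λ n → split-term n)) ⟩
    + g₀ 0 * S 0 m + sumℤ m (λ n → + g₀ (suc n) * S (suc n) m + + c * (+ g₂ n * S (suc n) m))
  ≡⟨ cong (_+_ (+ g₀ 0 * S 0 m)) (sum-+ m _ _) ⟩
    + g₀ 0 * S 0 m + (sumℤ m (λ n → + g₀ (suc n) * S (suc n) m) + sumℤ m (λ n → + c * (+ g₂ n * S (suc n) m)))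
  ≡⟨ ℤP.+-assoc (+ g₀ 0 * S 0 m) _ _ ⟨
    (+ g₀ 0 * S 0 m + sumℤ m (λ n → + g₀ (suc n) * S (suc n) m)) + sumℤ m (λ n → + c * (+ g₂ n * S (suc n) m))
  ≡⟨ cong₂ _+_ (sym (sum-head m (λ n → + g₀ n * S n m))) (sum-*ˡ m (+ c) _) ⟩
    wsum g₀ S m + + c * sumℤ m (λ n → + g₂ n * S (suc n) m)
  ≡⟨ cong (λ z → wsum g₀ S m + + c * z) (sym (sum-truncate m (suc m) (λ n → + g₂ n * S (suc n) m) (ℕP.n≤1+n m)
       (λ n m≤n → trans (cong (+ g₂ n *_) (graded (suc n) m (s≤s m≤n))) (ℤP.*-zeroʳ (+ g₂ n))))) ⟩
    wsum g₀ S m + + c * wsum g₂ (λ n → S (suc n)) m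
  ≡⟨ cong (_+_ (wsum g₀ S m)) (const-⊗ (+ c) (wsum g₂ (λ n → S (suc n))) m) ⟨
    (wsum g₀ S ⊕ (const (+ c) ⊗ wsum g₂ (λ n → S (suc n)))) m ∎
  where
  open ≡-Reasoning
  split-term : ∀ n → + g₁ (suc n) * S (suc n) m ≡ + g₀ (suc n) * S (suc n) m + + c * (+ g₂ n * S (suc n) m)
  split-term n = begin
      + g₁ (suc n) * S (suc n) m
    ≡⟨ cong (λ k → + k * S (suc n) m) (eq n) ⟩
      + (g₀ (suc n) Nat.+ c Nat.* g₂ n) * S (suc n) m
    ≡⟨ cong (_* S (suc n) m) (trans (ℤP.pos-+ (g₀ (suc n)) (c Nat.* g₂ n)) (cong (_+_ (+ g₀ (suc n))) (ℤP.pos-* c (g₂ n)))) ⟩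
      (+ g₀ (suc n) + + c * + g₂ n) * S (suc n) m
    ≡⟨ expand (+ g₀ (suc n)) (+ c) (+ g₂ n) (S (suc n) m) ⟩
      + g₀ (suc n) * S (suc n) m + + c * (+ g₂ n * S (suc n) m) ∎
    where
    expand : ∀ (a c b x : ℤ) → (a + c * b) * x ≡ a * x + c * (b * x)
    expand = solve-∀

K : ℕ → ℕ → Series
K α β = wsum (G α β) (T β)

-cx² : ℕ → Series
-cx² c = neg (const (+ c) ⊗ pow X 2)

-cx²-⊗-wsum : ∀ c g γ → (-cx² c ⊗ wsum g (T (suc γ))) ≗ neg (const (+ c) ⊗ wsum g (λ n → T γ (suc n)))
-cx²-⊗-wsum c g γ = begin
  -cx² c ⊗ wsum g (T (suc γ))                         ≈⟨ ⊗-negˡ (const (+ c) ⊗ pow X 2) (wsum g (T (suc γ))) ⟩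
  neg ((const (+ c) ⊗ pow X 2) ⊗ wsum g (T (suc γ)))  ≈⟨ neg-cong (⊗-assoc (const (+ c)) (pow X 2) (wsum g (T (suc γ)))) ⟩
  neg (const (+ c) ⊗ (pow X 2 ⊗ wsum g (T (suc γ))))  ≈⟨ neg-cong (⊗-congʳ (const (+ c)) (⊗-wsum g (T-order (suc γ)) (pow X 2))) ⟩
  neg (const (+ c) ⊗ wsum g (λ n → pow X 2 ⊗ T (suc γ) n))
    ≈⟨ neg-cong (⊗-congʳ (const (+ c)) (wsum-congʳ g (T-raise-n γ))) ⟩
  neg (const (+ c) ⊗ wsum g (λ n → T γ (suc n)))      ∎
  where open ≗-Reasoning

1-x-⊗-wsum : ∀ g γ → ((one ⊖ X) ⊗ wsum g (T (suc γ))) ≗ wsum g (T γ)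
1-x-⊗-wsum g γ = ≗.trans (⊗-wsum g (T-order (suc γ)) (one ⊖ X)) (wsum-congʳ g (T-lower-γ γ))

⊕-cancel : ∀ f g → ((f ⊕ g) ⊕ neg g) ≗ f
⊕-cancel f g n = cancel (f n) (g n)
  where
  cancel : ∀ (a b : ℤ) → a + b + - b ≡ a
  cancel = solve-∀

wsum-recurrence : ∀ γ (g₁ g₀ g₂ : ℕ → ℕ) c → g₁ 0 ≡ g₀ 0 →
  (∀ n → g₁ (suc n) ≡ g₀ (suc n) Nat.+ c Nat.* g₂ n) →
  ∀ P → P ≗ wsum g₁ (T γ) → wsum g₀ (T γ) ≗ (P ⊕ (-cx² c ⊗ wsum g₂ (T (suc γ))))
wsum-recurrence γ g₁ g₀ g₂ c eq₀ eq P P≗ = ≗.sym (begin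
  P ⊕ (-cx² c ⊗ wsum g₂ (T (suc γ)))           ≈⟨ ⊕-cong P≗ (-cx²-⊗-wsum c g₂ γ) ⟩
  wsum g₁ (T γ) ⊕ neg Q                         ≈⟨ ⊕-cong (wsum-split g₁ g₀ g₂ c (T-order γ) eq₀ eq) (λ _ → refl) ⟩
  (wsum g₀ (T γ) ⊕ Q) ⊕ neg Q                   ≈⟨ ⊕-cancel (wsum g₀ (T γ)) Q ⟩
  wsum g₀ (T γ)                                 ∎)
  where
  open ≗-Reasoning
  Q : Series
  Q = const (+ c) ⊗ wsum g₂ (λ n → T γ (suc n))

K-recurrence-even : ∀ a → K (suc a) a ≗ (((one ⊖ X) ⊗ K (suc a) (suc a)) ⊕ (-cx² (suc a) ⊗ K (suc (suc a)) (suc a)))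
K-recurrence-even a = wsum-recurrence a (G (suc a) (suc a)) (G (suc a) a) (G (suc (suc a)) (suc a)) (suc a)
  refl (G-step-β (suc a) a) _ (1-x-⊗-wsum (G (suc a) (suc a)) a)

K-recurrence-odd : ∀ a → K (suc a) (suc a) ≗ ((one ⊗ K (suc (suc a)) (suc a)) ⊕ (-cx² (suc a) ⊗ K (suc (suc a)) (suc (suc a))))
K-recurrence-odd a = wsum-recurrence (suc a) (G (suc (suc a)) (suc a)) (G (suc a) (suc a)) (G (suc (suc a)) (suc (suc a))) (suc a)
  refl (G-step-α (suc a) (suc a)) _ (one-⊗ (K (suc (suc a)) (suc a)))

K-1-0 : K 1 0 ≗ one
K-1-0 m = begin
  wsum (G 1 0) (T 0) m   ≡⟨ sum-single m (λ n → + G 1 0 n * T 0 n m) (λ n _ → cong (λ k → + k * T 0 (suc n) m) (G-1-0 n)) ⟩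
  1ℤ * T 0 0 m           ≡⟨ ℤP.*-identityˡ (T 0 0 m) ⟩
  (one ⊗ one) m          ≡⟨ one-⊗ one m ⟩
  one m                  ∎
  where open ≡-Reasoning

K-1-1 : ∀ m → K 1 1 m ≡ + sumℕ (suc m) (λ k → ((m ∸ k) C k) Nat.* (k !))
K-1-1 m = trans (sum-cong (suc m) term) (sum-pos (suc m) (λ k → ((m ∸ k) C k) Nat.* (k !)))
  where
  term : ∀ k → + G 1 1 k * T 1 k m ≡ + (((m ∸ k) C k) Nat.* (k !))
  term k = begin
    + G 1 1 k * T 1 k m                ≡⟨ cong₂ _*_ (cong +_ (G-1-1 k)) (T-1 k m) ⟩
    + (k !) * + ((m ∸ k) C k)          ≡⟨ ℤP.pos-* (k !) ((m ∸ k) C k) ⟨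
    + ((k !) Nat.* ((m ∸ k) C k))      ≡⟨ cong +_ (ℕP.*-comm (k !) ((m ∸ k) C k)) ⟩
    + (((m ∸ k) C k) Nat.* (k !))      ∎
    where open ≡-Reasoning

L : ℕ → Series
L j = K (suc (half j)) (half (suc j))

double : ℕ → ℕ
double zero    = 0
double (suc a) = suc (suc (double a))

data Parity : ℕ → Set where
  even : ∀ a → Parity (double a)
  odd  : ∀ a → Parity (suc (double a))

parity : ∀ n → Parity n
parity zero          = even 0
parity (suc zero)    = odd 0
parity (suc (suc n)) with parity n
... | even a = even (suc a)
... | odd a  = odd (suc a)

half-double : ∀ a → half (double a) ≡ a
half-double zero    = refl
half-double (suc a) = cong suc (half-double a)

half-suc-double : ∀ a → half (suc (double a)) ≡ a
half-suc-double zero    = refl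
half-suc-double (suc a) = cong suc (half-suc-double a)

bF-odd : ∀ a → bF (suc (double a)) ≡ one ⊖ X
bF-odd zero    = refl
bF-odd (suc a) = bF-odd a

bF-even : ∀ a → bF (suc (suc (double a))) ≡ one
bF-even zero    = refl
bF-even (suc a) = bF-even a

L-recurrence : ∀ i → L i ≗ ((bF (suc i) ⊗ L (suc i)) ⊕ (aF (suc (suc i)) ⊗ L (suc (suc i))))
L-recurrence i with parity i
... | even a rewrite half-double a | half-suc-double a | bF-odd a  = K-recurrence-even a
... | odd a  rewrite half-double a | half-suc-double a | bF-even a = K-recurrence-odd a

bF-unit : ∀ j → bF (suc j) 0 ≡ 1ℤ
bF-unit zero          = refl
bF-unit (suc zero)    = refl
bF-unit (suc (suc j)) = bF-unit j

aF-order : ∀ j → aF (suc (suc j)) 0 ≡ 0ℤ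
aF-order j = cong -_ (trans (const-⊗ (+ half (suc (suc j))) (pow X 2) 0) (ℤP.*-zeroʳ (+ half (suc (suc j)))))

open Convergence aF bF L bF-unit aF-order L-recurrence using (inverse-tail)

-- The second statement: the convergents are 0 + 1/(tail at level 1) → L_1 = K(1,1).
second-cf : ∀ n → CFCoeff aF bF n (+ sumℕ (suc n) (λ k → ((n ∸ k) C k) Nat.* (k !)))
second-cf n = suc n , λ { (suc d) (s≤s n≤d) → begin
    const 0ℤ n + (one ⊗ inv (cfTail aF bF 1 d)) n   ≡⟨ cong₂ _+_ (const-0 n) (one-⊗ (inv (cfTail aF bF 1 d)) n) ⟩
    0ℤ + inv (cfTail aF bF 1 d) n                   ≡⟨ ℤP.+-identityˡ _ ⟩
    inv (cfTail aF bF 1 d) n                        ≡⟨ inverse-tail K-1-0 d n n≤d ⟩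
    K 1 1 n                                         ≡⟨ K-1-1 n ⟩
    + sumℕ (suc n) (λ k → ((n ∸ k) C k) Nat.* (k !)) ∎ }
  where
  open ≡-Reasoning
  const-0 : ∀ n → const 0ℤ n ≡ 0ℤ
  const-0 zero    = refl
  const-0 (suc n) = refl

-- [k]_{-1} is 1 for odd k and 0 for even k, so b_k depends only on the parity of k.
qint-period : ∀ k → qint -1ℤ (suc (suc (suc k))) ≡ qint -1ℤ (suc k)
qint-period k = begin
  qint -1ℤ (suc k) + -1ℤ ^ suc k + -1ℤ ^ suc (suc k)     ≡⟨ ℤP.+-assoc (qint -1ℤ (suc k)) _ _ ⟩
  qint -1ℤ (suc k) + (-1ℤ ^ suc k + -1ℤ * -1ℤ ^ suc k)   ≡⟨ cong (_+_ (qint -1ℤ (suc k))) (cancel (-1ℤ ^ suc k)) ⟩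
  qint -1ℤ (suc k) + 0ℤ                                  ≡⟨ ℤP.+-identityʳ _ ⟩
  qint -1ℤ (suc k)                                       ∎
  where
  open ≡-Reasoning
  cancel : ∀ x → x + -1ℤ * x ≡ 0ℤ
  cancel = solve-∀

parity-bit : ℕ → ℕ
parity-bit zero          = 0
parity-bit (suc zero)    = 1
parity-bit (suc (suc n)) = parity-bit n

half-suc : ∀ n → half (suc n) ≡ parity-bit n Nat.+ half n
half-suc zero          = refl
half-suc (suc zero)    = refl
half-suc (suc (suc n)) = trans (cong suc (half-suc n)) (sym (ℕP.+-suc (parity-bit n) (half n)))

qbinom-0 : ∀ q n → qbinom q n 0 ≡ 1ℤ
qbinom-0 q zero    = refl
qbinom-0 q (suc n) = refl

qbinom-1 : ∀ n → qbinom -1ℤ n 1 ≡ + parity-bit n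
qbinom-1 zero          = refl
qbinom-1 (suc zero)    = refl
qbinom-1 (suc (suc n)) rewrite qbinom-0 -1ℤ n | qbinom-1 n = flip (+ parity-bit n)
  where
  flip : ∀ x → 1ℤ + -1ℤ * (1ℤ + -1ℤ * x) ≡ x
  flip = solve-∀

qbinom-2 : ∀ n → qbinom -1ℤ n 2 ≡ + half n
qbinom-2 zero    = refl
qbinom-2 (suc n) rewrite qbinom-1 n | qbinom-2 n = begin
    + parity-bit n + -1ℤ * -1ℤ * + half n   ≡⟨ cong (_+_ (+ parity-bit n)) (ℤP.*-identityˡ (+ half n)) ⟩
    + parity-bit n + + half n               ≡⟨ ℤP.pos-+ (parity-bit n) (half n) ⟨
    + (parity-bit n Nat.+ half n)           ≡⟨ cong +_ (half-suc n) ⟨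
    + half (suc n)                          ∎
  where open ≡-Reasoning

bE-bF : ∀ k → bE -1ℤ (suc k) ≗ bF (suc k)
bE-bF zero          = ⊕-cong {f = one} (λ _ → refl) (neg-cong (one-⊗ X))
bE-bF (suc zero)    n = trans (cong (λ z → one n - z) (const-⊗ 0ℤ X n)) (ℤP.+-identityʳ (one n))
bE-bF (suc (suc k)) rewrite qint-period k = bE-bF k

aE-aF : ∀ k → aE -1ℤ (suc (suc k)) ≗ aF (suc (suc k))
aE-aF k n rewrite qbinom-2 (suc (suc k)) = refl

tails-agree : ∀ j d → cfTail (aE -1ℤ) (bE -1ℤ) (suc j) d ≗ cfTail aF bF (suc j) d
tails-agree j zero    = bE-bF j
tails-agree j (suc d) = ⊕-cong (bE-bF j) (⊗-cong (aE-aF j) (inv-cong (tails-agree (suc j) d)))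

-- E_0(-1) = 1: every convergent is 1 + x·(...), with constant term 1.
E-0 : E-is -1ℤ 0 1ℤ
E-0 = 1 , λ { (suc d) _ → refl }

-- E_{n+1}(-1) = [x^n] K(1,1), since the first fraction is 1 + x / (tail at level 1).
E-suc : ∀ n → 1 ≤ n → E-is -1ℤ n (+ sumℕ n (λ k → ((n ∸ k ∸ 1) C k) Nat.* (k !)))
E-suc (suc n) _ = suc (suc n) , λ { (suc d) (s≤s n<d) → begin
    0ℤ + (X ⊗ inv (cfTail (aE -1ℤ) (bE -1ℤ) 1 d)) (suc n)   ≡⟨ ℤP.+-identityˡ _ ⟩
    (X ⊗ inv (cfTail (aE -1ℤ) (bE -1ℤ) 1 d)) (suc n)        ≡⟨ X-⊗ (inv (cfTail (aE -1ℤ) (bE -1ℤ) 1 d)) (suc n) ⟩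
    inv (cfTail (aE -1ℤ) (bE -1ℤ) 1 d) n                    ≡⟨ inv-cong (tails-agree 0 d) n ⟩
    inv (cfTail aF bF 1 d) n                                ≡⟨ inverse-tail K-1-0 d n (ℕP.<⇒≤ n<d) ⟩
    K 1 1 n                                                 ≡⟨ K-1-1 n ⟩
    + sumℕ (suc n) (λ k → ((n ∸ k) C k) Nat.* (k !))        ≡⟨ cong +_ (sumℕ-cong (suc n) reindex) ⟩
    + sumℕ (suc n) (λ k → ((suc n ∸ k ∸ 1) C k) Nat.* (k !)) ∎ }
  where
  open ≡-Reasoning
  reindex : ∀ k → ((n ∸ k) C k) Nat.* (k !) ≡ ((suc n ∸ k ∸ 1) C k) Nat.* (k !)
  reindex k = cong (λ m → (m C k) Nat.* (k !)) (sym (trans (ℕP.∸-+-assoc (suc n) k 1) (cong (suc n ∸_) (ℕP.+-comm k 1))))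

theorem7p1 : E-is (- (+ 1)) 0 (+ 1)
    × (∀ n → 1 ≤ n → E-is (- (+ 1)) n (+ sumℕ n (λ k → ((n ∸ k ∸ 1) C k) Data.Nat.* (k !))))
    × (∀ n → CFCoeff aF bF n (+ sumℕ (suc n) (λ k → ((n ∸ k) C k) Data.Nat.* (k !))))
theorem7p1 = E-0 , E-suc , second-cf
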